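{- For every positive integer $n$ there is a number $M$ such that, for every prime $p>M$, the number $np$ satisfies Condition 1 with $p$ and another prime: there is a prime $q\ne p$ such that for all integers $j$ with $1\le j\le np-1$, the binomial coefficient $\binom{np}{j}$ is divisible by $p$ or by $q$.
   Context: A positive integer $N$ satisfies Condition 1 with primes $p$ and $q$ if for all integers $j$ with $1\le j\le N-1$ the binomial coefficient $\binom{N}{j}$ is divisible by $p$ or by $q$. -}

module Defs where

open import Data.Nat using (ℕ; _≤_; _∸_)
open import Data.Nat.Divisibility using (_∣_)
open import Data.Nat.Combinatorics using (_C_)
open import Data.Sum using (_⊎_)

Condition1 : ℕ → ℕ → ℕ → Set
Condition1 N p q = ∀ j → 1 ≤ j → j ≤ N ∸ 1 → (p ∣ N C j) ⊎ (q ∣ N C j)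

module Submission where

-- For a prime p > n! the number p + 1 does not
-- divide n!, so p + 1 has a prime-power divisor A = q^e with A > n; q ≠ p
-- because q ∣ p + 1.  Let 1 ≤ j < np.
--   * If p ∤ j, then p ∣ C(np, j) because p ∣ np: the absorption identity
--     j·C(N, j) = N·C(N-1, j-1) shows that a prime power dividing N but not j
--     forces its prime to divide C(N, j).
--   * If j = kp with 1 ≤ k < n, then p ≡ -1 (mod A), so the last base-A digits
--     of np and kp are A - n < A - k.  Such a borrow in the last digit forces
--     q ∣ C(np, kp) (a special case of Kummer's theorem), proved by induction
--     on the top digit with Pascal's rule.

open import Defs
open import Data.Nat using (ℕ; _*_; _<_; _≤_)
open import Data.Nat.Primality using (Prime)
open import Data.Product using (∃; _×_)
open import Relation.Binary.PropositionalEquality using (_≢_)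

open import Data.Nat using (zero; suc; _+_; _∸_; _^_; _!; z≤n; s≤s; z<s; _<?_; nonTrivial⇒n>1; nonTrivial⇒≢1)
open import Data.Nat.Properties
open import Data.Nat.Divisibility
open import Data.Nat.Combinatorics using (_C_; k>n⇒nCk≡0; nC1≡n; nCk+nC[k+1]≡[n+1]C[k+1])
open import Data.Nat.Induction using (<-rec)
open import Data.Nat.Primality using (euclidsLemma; prime⇒nonZero; prime⇒nonTrivial)
open import Data.Nat.Primality.Factorisation using (factorise; PrimeFactorisation)
open import Data.Nat.ListAction using (product)
open import Data.List using ([]; _∷_)
open import Data.List.Relation.Unary.All using (All; _∷_)
open import Data.Product using (∃₂; _,_)
open import Data.Sum using (_⊎_; inj₁; inj₂)
open import Data.Empty using (⊥-elim)
open import Function using (_∘_)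
open import Relation.Nullary using (¬_; yes; no)
open import Relation.Binary.PropositionalEquality
  using (_≡_; refl; sym; trans; cong; cong₂; subst; subst₂; module ≡-Reasoning)

absorption : ∀ N j → suc j * (suc N C suc j) ≡ suc N * (N C j)
absorption zero zero = refl
absorption zero (suc j)
  rewrite k>n⇒nCk≡0 {1} {suc (suc j)} (s≤s (s≤s z≤n))
        | k>n⇒nCk≡0 {0} {suc j} (s≤s z≤n) = *-zeroʳ (suc (suc j))
absorption (suc N) zero rewrite nC1≡n (suc (suc N)) =
  trans (+-identityʳ _) (sym (*-identityʳ _))
absorption (suc N) (suc j) = begin
    suc (suc j) * (suc (suc N) C suc (suc j))
  ≡⟨ cong (suc (suc j) *_) (sym (nCk+nC[k+1]≡[n+1]C[k+1] (suc N) (suc j))) ⟩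
    suc (suc j) * (a + b)
  ≡⟨ *-distribˡ-+ (suc (suc j)) a b ⟩
    (a + suc j * a) + suc (suc j) * b
  ≡⟨ cong₂ (λ u v → (a + u) + v) (absorption N j) (absorption N (suc j)) ⟩
    (a + suc N * c) + suc N * d
  ≡⟨ +-assoc a (suc N * c) (suc N * d) ⟩
    a + (suc N * c + suc N * d)
  ≡⟨ cong (a +_) (sym (*-distribˡ-+ (suc N) c d)) ⟩
    a + suc N * (c + d)
  ≡⟨ cong (λ u → a + suc N * u) (nCk+nC[k+1]≡[n+1]C[k+1] N j) ⟩
    suc (suc N) * a
  ∎
  where
  open ≡-Reasoning
  a = suc N C suc j
  b = suc N C suc (suc j)
  c = N C j
  d = N C suc j

prime^∣-cancelʳ : ∀ {q y} → Prime q → ¬ q ∣ y → ∀ a x → q ^ a ∣ x * y → q ^ a ∣ x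
prime^∣-cancelʳ pq q∤y zero x _ = 1∣ x
prime^∣-cancelʳ {q} {y} pq q∤y (suc a) x q^[1+a]∣xy
  with euclidsLemma x y pq (∣-trans (m∣m*n (q ^ a)) q^[1+a]∣xy)
... | inj₂ q∣y = ⊥-elim (q∤y q∣y)
... | inj₁ (divides x′ refl) =
  subst (q ^ suc a ∣_) (*-comm q x′) (*-monoʳ-∣ q (prime^∣-cancelʳ pq q∤y a x′ q^a∣x′y))
  where
  instance _ = prime⇒nonZero pq
  xy≡q[x′y] : x′ * q * y ≡ q * (x′ * y)
  xy≡q[x′y] = trans (cong (_* y) (*-comm x′ q)) (*-assoc q x′ y)
  q^a∣x′y : q ^ a ∣ x′ * y
  q^a∣x′y = *-cancelˡ-∣ q (subst (q * q ^ a ∣_) xy≡q[x′y] q^[1+a]∣xy)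

prime^*coprime∣ : ∀ {q y m} → Prime q → ¬ q ∣ y → ∀ a → q ^ a ∣ m → y ∣ m → q ^ a * y ∣ m
prime^*coprime∣ {y = y} pq q∤y a q^a∣m (divides w refl) =
  *-monoˡ-∣ y (prime^∣-cancelʳ pq q∤y a w q^a∣m)

-- If a power q^e of a prime divides N but not j, then q ∣ C(N, j): otherwise
-- q^e would pass from (j+1)·C(N+1, j+1) = (N+1)·C(N, j) to j + 1.
prime∣binomial : ∀ {q} → Prime q → ∀ e N j → q ^ e ∣ N → ¬ q ^ e ∣ j → q ∣ N C j
prime∣binomial pq e N zero _ q^e∤0 = ⊥-elim (q^e∤0 (_ ∣0))
prime∣binomial {q} pq e zero (suc j) _ _ =
  subst (q ∣_) (sym (k>n⇒nCk≡0 {0} {suc j} (s≤s z≤n))) (q ∣0)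
prime∣binomial {q} pq e (suc N) (suc j) q^e∣N q^e∤j with q ∣? (suc N C suc j)
... | yes q∣C = q∣C
... | no q∤C = ⊥-elim (q^e∤j (prime^∣-cancelʳ pq q∤C e (suc j)
        (subst (q ^ e ∣_) (sym (absorption N j)) (∣-trans q^e∣N (m∣m*n _)))))

prime∣binomial¹ : ∀ {q} → Prime q → ∀ N j → q ∣ N → ¬ q ∣ j → q ∣ N C j
prime∣binomial¹ {q} pq N j q∣N q∤j =
  prime∣binomial pq 1 N j (subst (_∣ N) q≡q¹ q∣N) (q∤j ∘ subst (_∣ j) (sym q≡q¹))
  where
  q≡q¹ : q ≡ q ^ 1
  q≡q¹ = sym (*-identityʳ q)

-- Borrow in the last digit: with A = q^e, if the last base-A digit r of the
-- top is smaller than the last digit s of the bottom, q ∣ C(mA + r, tA + s).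
borrow∣binomial : ∀ {q} → Prime q → ∀ e m t r s → r < s → s < q ^ e →
                  q ∣ (m * q ^ e + r) C (t * q ^ e + s)
borrow∣binomial {q} pq e m t zero (suc s) _ s<A =
  prime∣binomial pq e _ _ (subst (q ^ e ∣_) (sym (+-identityʳ _)) (n∣m*n m)) A∤bottom
  where
  A∤bottom : ¬ q ^ e ∣ t * q ^ e + suc s
  A∤bottom A∣ = <⇒≱ s<A (∣⇒≤ (∣m+n∣m⇒∣n A∣ (n∣m*n t)))
borrow∣binomial {q} pq e m t (suc r) (suc s) (s≤s r<s) s<A
  rewrite +-suc (m * q ^ e) r | +-suc (t * q ^ e) s =
  subst (q ∣_) (nCk+nC[k+1]≡[n+1]C[k+1] (m * q ^ e + r) (t * q ^ e + s))
    (∣m∣n⇒∣m+n (borrow∣binomial pq e m t r s r<s (<-trans (n<1+n s) s<A))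
       (subst (λ z → q ∣ (m * q ^ e + r) C z) (+-suc (t * q ^ e) s)
          (borrow∣binomial pq e m t r (suc s) (m<n⇒m<1+n r<s) s<A)))

primeDivisor : ∀ x → 1 < x → ∃ λ q → Prime q × q ∣ x
primeDivisor x@(suc _) 1<x =
  fromFactors (PrimeFactorisation.factors f) (PrimeFactorisation.isFactorisation f)
              (PrimeFactorisation.factorsPrime f)
  where
  f = factorise x
  fromFactors : ∀ l → x ≡ product l → All Prime l → ∃ λ q → Prime q × q ∣ x
  fromFactors []      x≡1 _          = ⊥-elim (<⇒≢ 1<x (sym x≡1))
  fromFactors (q ∷ l) x≡ql (pq ∷ _) = q , pq , divides (product l) (trans x≡ql (*-comm q (product l)))

primePowerSplit : ∀ {q} → Prime q → ∀ x → 0 < x → ∃₂ λ a y → x ≡ q ^ a * y × ¬ q ∣ y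
primePowerSplit {q} pq = <-rec _ split
  where
  1<q : 1 < q
  1<q = nonTrivial⇒n>1 q {{prime⇒nonTrivial pq}}
  split : ∀ x → (∀ {x′} → x′ < x → 0 < x′ → ∃₂ λ a y → x′ ≡ q ^ a * y × ¬ q ∣ y) →
          0 < x → ∃₂ λ a y → x ≡ q ^ a * y × ¬ q ∣ y
  split x rec 0<x with q ∣? x
  ... | no q∤x = 0 , x , sym (+-identityʳ x) , q∤x
  ... | yes (divides zero refl) = ⊥-elim (<-irrefl refl 0<x)
  ... | yes (divides x′@(suc _) refl) with rec (m<m*n x′ q 1<q) z<s
  ...   | a , y , x′≡q^a*y , q∤y =
    suc a , y , trans (*-comm x′ q) (trans (cong (q *_) x′≡q^a*y) (sym (*-assoc q (q ^ a) y))) , q∤y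

≤⇒∣! : ∀ {m n} → 0 < m → m ≤ n → m ∣ n !
≤⇒∣! {suc m} _ m≤n = ∣-trans (m∣m*n (m !)) (m≤n⇒m!∣n! m≤n)

-- Every positive x either divides n! or has a prime-power divisor exceeding n:
-- if the q-part q^a of x is at most n it divides n!, and it combines with the
-- (by induction) n!-dividing, q-free rest of x.
largePrimePowerDivisor : ∀ n x → 0 < x →
                         (∃₂ λ q e → Prime q × q ^ e ∣ x × n < q ^ e) ⊎ x ∣ n !
largePrimePowerDivisor n = <-rec _ step
  where
  Dichotomy : ℕ → Set
  Dichotomy x = (∃₂ λ q e → Prime q × q ^ e ∣ x × n < q ^ e) ⊎ x ∣ n !
  step : ∀ x → (∀ {y} → y < x → 0 < y → Dichotomy y) → 0 < x → Dichotomy x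
  step (suc zero) _ _ = inj₂ (1∣ (n !))
  step x@(suc (suc _)) rec _ with primeDivisor x (s≤s (s≤s z≤n))
  ... | q , pq , q∣x with primePowerSplit pq x z<s
  ... | zero , y , x≡y , q∤y = ⊥-elim (q∤y (subst (q ∣_) (trans x≡y (*-identityˡ y)) q∣x))
  ... | _ , zero , _ , q∤0 = ⊥-elim (q∤0 (q ∣0))
  ... | a@(suc _) , y@(suc _) , x≡q^a*y , q∤y with n <? q ^ a
  ...   | yes n<q^a = inj₁ (q , a , pq , divides y (trans x≡q^a*y (*-comm (q ^ a) y)) , n<q^a)
  ...   | no n≮q^a with rec y<x z<s
    where
    y<x : y < x
    y<x = subst (y <_) (trans (*-comm y (q ^ a)) (sym x≡q^a*y))
            (m<m*n y (q ^ a) (^-monoʳ-< q (nonTrivial⇒n>1 q {{prime⇒nonTrivial pq}}) {0} {a} z<s))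
  ...     | inj₁ (r , e , pr , r^e∣y , n<r^e) =
    inj₁ (r , e , pr , ∣-trans r^e∣y (divides (q ^ a) x≡q^a*y) , n<r^e)
  ...     | inj₂ y∣n! =
    inj₂ (subst (_∣ n !) (sym x≡q^a*y)
      (prime^*coprime∣ pq q∤y a (≤⇒∣! (m^n>0 q {{prime⇒nonZero pq}} a) (≮⇒≥ n≮q^a)) y∣n!))

lastDigit : ∀ c u A p → c ≤ A → 1 ≤ c → suc p ≡ u * A → c * p ≡ (c * u ∸ 1) * A + (A ∸ c)
lastDigit c@(suc _) u A p c≤A _ p+1≡uA with c * u in cu≡
... | zero = ⊥-elim (0≢1+n (begin
    0           ≡⟨ cong (_* A) cu≡ ⟨
    c * u * A   ≡⟨ *-assoc c u A ⟩
    c * (u * A) ≡⟨ cong (c *_) p+1≡uA ⟨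
    c * suc p   ≡⟨ *-suc c p ⟩
    c + c * p   ∎))
  where open ≡-Reasoning
... | suc w = +-cancelʳ-≡ c (c * p) (w * A + (A ∸ c)) (begin
    c * p + c             ≡⟨ +-comm (c * p) c ⟩
    c + c * p             ≡⟨ *-suc c p ⟨
    c * suc p             ≡⟨ cong (c *_) p+1≡uA ⟩
    c * (u * A)           ≡⟨ *-assoc c u A ⟨
    c * u * A             ≡⟨ cong (_* A) cu≡ ⟩
    A + w * A             ≡⟨ +-comm A (w * A) ⟩
    w * A + A             ≡⟨ cong (w * A +_) (m∸n+n≡m c≤A) ⟨
    w * A + ((A ∸ c) + c) ≡⟨ +-assoc (w * A) (A ∸ c) c ⟨
    w * A + (A ∸ c) + c   ∎)
  where open ≡-Reasoning

≤∸1⇒< : ∀ {j N} → 1 ≤ j → j ≤ N ∸ 1 → j < N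
≤∸1⇒< {N = zero}  1≤j j≤0 = ⊥-elim (<⇒≱ 1≤j j≤0)
≤∸1⇒< {N = suc _} _   j≤N = s≤s j≤N

primePower∣suc⇒condition1 : ∀ n p q e → Prime p → Prime q → 1 ≤ n → n < q ^ e →
                            q ^ e ∣ suc p → Condition1 (n * p) p q
primePower∣suc⇒condition1 n p q e pp pq 1≤n n<A (divides u p+1≡uA) j 1≤j j≤np-1
  with p ∣? j
... | no p∤j = inj₁ (prime∣binomial¹ pp (n * p) j (n∣m*n n) p∤j)
... | yes (divides zero refl) = ⊥-elim (<-irrefl refl 1≤j)
... | yes (divides k@(suc _) refl) =
  inj₂ (subst₂ (λ a b → q ∣ a C b)
          (sym (lastDigit n u A p n≤A 1≤n p+1≡uA)) (sym (lastDigit k u A p k≤A z<s p+1≡uA))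
          (borrow∣binomial pq e (n * u ∸ 1) (k * u ∸ 1) (A ∸ n) (A ∸ k)
             (∸-monoʳ-< k<n n≤A) (∸-monoʳ-< z<s k≤A)))
  where
  A = q ^ e
  n≤A : n ≤ A
  n≤A = <⇒≤ n<A
  kp<np : k * p < n * p
  kp<np = ≤∸1⇒< 1≤j j≤np-1
  k<n : k < n
  k<n = *-cancelʳ-< p k n kp<np
  k≤A : k ≤ A
  k≤A = <⇒≤ (<-trans k<n n<A)

prime∤suc : ∀ {p} → Prime p → ¬ p ∣ suc p
prime∤suc {p} pp p∣p+1 = nonTrivial⇒≢1 {{prime⇒nonTrivial pp}}
  (∣1⇒≡1 (∣m+n∣m⇒∣n (subst (p ∣_) (+-comm 1 p) p∣p+1) ∣-refl))

theorem5p2 : ∀ (n : ℕ) → 1 ≤ n → ∃ λ (M : ℕ) → ∀ (p : ℕ) → Prime p → M < p →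
    ∃ λ (q : ℕ) → Prime q × q ≢ p × Condition1 (n * p) p q
theorem5p2 n 1≤n = n ! , witness
  where
  witness : ∀ p → Prime p → n ! < p → ∃ λ q → Prime q × q ≢ p × Condition1 (n * p) p q
  witness p pp n!<p with largePrimePowerDivisor n (suc p) z<s
  ... | inj₂ p+1∣n! = ⊥-elim (<⇒≱ n!<p (≤-trans (n≤1+n p) (∣⇒≤ {{n !≢0}} p+1∣n!)))
  ... | inj₁ (q , zero , _ , _ , n<1) = ⊥-elim (<⇒≱ n<1 1≤n)
  ... | inj₁ (q , e@(suc e′) , pq , q^e∣p+1 , n<q^e) =
    q , pq , q≢p , primePower∣suc⇒condition1 n p q e pp pq 1≤n n<q^e q^e∣p+1
    where
    q≢p : q ≢ p
    q≢p refl = prime∤suc pp (∣-trans (m∣m*n (q ^ e′)) q^e∣p+1)
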